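{- Let $\Sigma$ be a finite alphabet, let $p$ and $q$ be words on $\Sigma$ of equal length with $p \neq q$, and let $n \in \mathbb{N}$. For every $w \in A_n(p)$, there exists a least non-negative integer $i$ such that $L^{i}(w)$ contains no occurrence of $q$, and $\phi_L(w) := L^{i}(w)$ belongs to $A_n(q)$.
   Context: $\mathbb{N}$ denotes the non-negative integers. For a word $p$ on $\Sigma$, $A_n(p)$ is the set of words of length $n$ on $\Sigma$ that do not contain $p$ as a contiguous factor. The single scan function $L$ acts on a word by replacing the leftmost (contiguous) occurrence of $q$ with $p$; if the word contains no occurrence of $q$, $L$ acts as the identity. $L^i$ denotes the $i$-fold iterate of $L$. -}

module Defs where

open import Data.Nat using (ℕ; zero; suc)
open import Data.Fin using (Fin)
open import Data.Fin.Properties using (_≟_)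
open import Data.List using (List; []; _∷_; _++_; length; drop)
open import Data.Bool using (Bool; true; false; if_then_else_)
open import Data.Product using (∃; ∃-syntax; _×_)
open import Relation.Nullary using (¬_; yes; no)
open import Relation.Binary.PropositionalEquality using (_≡_)

Word : ℕ → Set
Word k = List (Fin k)

Contains : ∀ {k} → Word k → Word k → Set
Contains u w = ∃[ xs ] ∃[ ys ] (w ≡ xs ++ u ++ ys)

A : ∀ {k} → ℕ → Word k → Word k → Set
A n p w = (length w ≡ n) × ¬ Contains p w

isPrefix : ∀ {k} → Word k → Word k → Bool
isPrefix [] w = true
isPrefix (x ∷ u) [] = false
isPrefix (x ∷ u) (y ∷ w) with x ≟ y
... | yes _ = isPrefix u w
... | no _ = false

L : ∀ {k} → (p q : Word k) → Word k → Word k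
L p q w with isPrefix q w
L p q w | true = p ++ drop (length q) w
L p q [] | false = []
L p q (x ∷ w) | false = x ∷ L p q w

iter : ∀ {A : Set} → ℕ → (A → A) → A → A
iter zero f a = a
iter (suc i) f a = f (iter i f a)

-- Fix the first position where p and q differ, p = u ++ b ∷ r₁ and q = u ++ a ∷ r₂ with b ≢ a.
-- Read a word as a binary number whose digits are 0 at the letter b and 1 elsewhere.
-- One application of L to a word containing q turns a factor u ++ a ∷ r₂ into u ++ b ∷ r₁
-- and keeps everything to its left and the length unchanged, so it lowers a 1-digit to a
-- 0-digit at a fixed position while only changing digits to its right: the number strictly
-- decreases. Hence the iteration reaches a q-free word, and since L preserves length, that
-- word lies in A_n(q).
module Submission where

open import Defs
open import Data.Nat using (ℕ; zero; suc; _+_; _*_; _^_; _<_; _≤_; z≤n; s≤s)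
open import Data.Nat.Properties
  using (+-monoʳ-<; *-monoˡ-≤; m≤m+n; ≤-trans; +-comm; suc-injective; +-cancelˡ-≡; module ≤-Reasoning)
open import Data.Nat.Induction using (<-wellFounded)
open import Data.Fin using (Fin)
open import Data.Fin.Properties using (_≟_)
open import Data.List using (List; []; _∷_; _++_; length; drop)
open import Data.List.Properties using (++-assoc; length-++)
open import Data.Bool using (true; false; if_then_else_)
open import Data.Product using (Σ; _×_; _,_)
open import Function using (_∘_)
open import Data.Empty using (⊥-elim)
open import Relation.Nullary using (¬_; Dec; yes; no; does)
open import Relation.Nullary.Decidable using (dec-true; dec-false)
open import Relation.Binary.PropositionalEquality
  using (_≡_; refl; sym; trans; cong; subst; _≢_)
open import Induction.WellFounded using (Acc; acc)

iter-suc : ∀ {X : Set} (F : X → X) i x → iter (suc i) F x ≡ iter i F (F x)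
iter-suc F zero    x = refl
iter-suc F (suc i) x = cong F (iter-suc F i x)

first-iterate-outside : ∀ {X : Set} (F : X → X) (P : X → Set) → (∀ x → Dec (P x)) →
  (μ : X → ℕ) → (∀ x → P x → μ (F x) < μ x) →
  ∀ x → Σ ℕ λ i → ¬ P (iter i F x) × (∀ j → j < i → P (iter j F x))
first-iterate-outside F P P? μ μ-decreases x = go x (<-wellFounded (μ x))
  where
  go : ∀ x → Acc _<_ (μ x) → Σ ℕ λ i → ¬ P (iter i F x) × (∀ j → j < i → P (iter j F x))
  go x (acc rec) with P? x
  ... | no ¬Px = 0 , ¬Px , λ _ ()
  ... | yes Px with go (F x) (rec (μ-decreases x Px))
  ...   | i , ¬P-i , P-below = suc i , subst (λ y → ¬ P y) (sym (iter-suc F i x)) ¬P-i , P-below′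
    where
    P-below′ : ∀ j → j < suc i → P (iter j F x)
    P-below′ zero    _         = Px
    P-below′ (suc j) (s≤s j<i) = subst P (sym (iter-suc F j x)) (P-below j j<i)

module Positional {A : Set} (base : ℕ) (digit : A → ℕ) (digit<base : ∀ x → digit x < base) where

  value : List A → ℕ
  value []       = 0
  value (x ∷ xs) = digit x * base ^ length xs + value xs

  value<base^length : ∀ xs → value xs < base ^ length xs
  value<base^length []       = s≤s z≤n
  value<base^length (x ∷ xs) = ≤-trans (+-monoʳ-< (digit x * b) (value<base^length xs))
    (subst (_≤ base * b) (+-comm b (digit x * b)) (*-monoˡ-≤ b (digit<base x)))
    where b = base ^ length xs

  value-head-< : ∀ {x y u v} → length u ≡ length v → digit y < digit x →
                 value (y ∷ u) < value (x ∷ v)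
  value-head-< {x} {y} {u} {v} |u|≡|v| y<x rewrite |u|≡|v| =
    ≤-trans (+-monoʳ-< (digit y * b) (subst (λ n → value u < base ^ n) |u|≡|v| (value<base^length u)))
      (≤-trans (subst (_≤ digit x * b) (+-comm b (digit y * b)) (*-monoˡ-≤ b y<x))
               (m≤m+n (digit x * b) (value v)))
    where b = base ^ length v

  value-++-monoʳ : ∀ t {u v} → length u ≡ length v → value u < value v →
                   value (t ++ u) < value (t ++ v)
  value-++-monoʳ []      _   u<v = u<v
  value-++-monoʳ (x ∷ t) {u} {v} |u|≡|v| u<v
    rewrite length-++ t {u} | length-++ t {v} | |u|≡|v| =
      +-monoʳ-< (digit x * base ^ (length t + length v)) (value-++-monoʳ t |u|≡|v| u<v)

module _ {k : ℕ} where

  isPrefix-sound : ∀ (q w : Word k) → isPrefix q w ≡ true → w ≡ q ++ drop (length q) w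
  isPrefix-sound []      w       _ = refl
  isPrefix-sound (x ∷ q) []      ()
  isPrefix-sound (x ∷ q) (y ∷ w) e with x ≟ y
  isPrefix-sound (x ∷ q) (x ∷ w) e | yes refl = cong (x ∷_) (isPrefix-sound q w e)
  isPrefix-sound (x ∷ q) (y ∷ w) () | no _

  isPrefix-++ : ∀ (q ys : Word k) → isPrefix q (q ++ ys) ≡ true
  isPrefix-++ []      ys = refl
  isPrefix-++ (x ∷ q) ys with x ≟ x
  ... | yes _  = isPrefix-++ q ys
  ... | no x≢x = ⊥-elim (x≢x refl)

  isPrefix-complete : ∀ {q w : Word k} ys → w ≡ q ++ ys → isPrefix q w ≡ true
  isPrefix-complete {q} ys refl = isPrefix-++ q ys

  ¬Contains-[] : ∀ {q : Word k} → isPrefix q [] ≡ false → ¬ Contains q []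
  ¬Contains-[] eq ([]    , ys , e) with () ← trans (sym (isPrefix-complete ys e)) eq
  ¬Contains-[] eq (_ ∷ _ , _  , ())

  Contains-∷⁻ : ∀ {q : Word k} {x w} → isPrefix q (x ∷ w) ≡ false → Contains q (x ∷ w) → Contains q w
  Contains-∷⁻ eq ([]     , ys , e) with () ← trans (sym (isPrefix-complete ys e)) eq
  Contains-∷⁻ eq (_ ∷ xs , ys , refl) = xs , ys , refl

  Contains? : ∀ (q w : Word k) → Dec (Contains q w)
  Contains? q w with isPrefix q w in eq
  ... | true = yes ([] , drop (length q) w , isPrefix-sound q w eq)
  Contains? q []      | false = no (¬Contains-[] eq)
  Contains? q (x ∷ w) | false with Contains? q w
  ... | yes (xs , ys , e) = yes (x ∷ xs , ys , cong (x ∷_) e)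
  ... | no ¬c             = no (¬c ∘ Contains-∷⁻ eq)

  L-length : ∀ (p q : Word k) → length p ≡ length q → ∀ w → length (L p q w) ≡ length w
  L-length p q |p|≡|q| w with isPrefix q w in eq
  ... | true = trans (length-++ p) (trans (cong (_+ length d) |p|≡|q|)
                 (trans (sym (length-++ q)) (cong length (sym (isPrefix-sound q w eq)))))
    where d = drop (length q) w
  L-length p q |p|≡|q| []      | false = refl
  L-length p q |p|≡|q| (x ∷ w) | false = cong suc (L-length p q |p|≡|q| w)

  iter-L-length : ∀ (p q : Word k) → length p ≡ length q → ∀ i w → length (iter i (L p q) w) ≡ length w
  iter-L-length p q |p|≡|q| zero    w = refl
  iter-L-length p q |p|≡|q| (suc i) w = trans (L-length p q |p|≡|q| _) (iter-L-length p q |p|≡|q| i w)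

  first-mismatch : ∀ (p q : Word k) → length p ≡ length q → p ≢ q →
    Σ (Word k) λ u → Σ (Fin k) λ b → Σ (Fin k) λ a → Σ (Word k) λ r₁ → Σ (Word k) λ r₂ →
      p ≡ u ++ b ∷ r₁ × q ≡ u ++ a ∷ r₂ × b ≢ a
  first-mismatch []      []      _ p≢q = ⊥-elim (p≢q refl)
  first-mismatch (x ∷ p) (y ∷ q) e p≢q with x ≟ y
  ... | no x≢y = [] , x , y , p , q , refl , refl , x≢y
  ... | yes refl with first-mismatch p q (suc-injective e) (λ p≡q → p≢q (cong (x ∷_) p≡q))
  ...   | u , b , a , r₁ , r₂ , refl , refl , b≢a = x ∷ u , b , a , r₁ , r₂ , refl , refl , b≢a

module _ {k : ℕ} (base : ℕ) (digit : Fin k → ℕ) (digit<base : ∀ x → digit x < base)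
         (u : Word k) {b a : Fin k} (r₁ r₂ : Word k)
         (|p|≡|q| : length (u ++ b ∷ r₁) ≡ length (u ++ a ∷ r₂)) (b<a : digit b < digit a) where

  open Positional base digit digit<base

  private
    p q : Word k
    p = u ++ b ∷ r₁
    q = u ++ a ∷ r₂

    |r₁|≡|r₂| : length r₁ ≡ length r₂
    |r₁|≡|r₂| = suc-injective (+-cancelˡ-≡ (length u) _ _
      (trans (sym (length-++ u)) (trans |p|≡|q| (length-++ u))))

  L-decreases : ∀ w → Contains q w → value (L p q w) < value w
  L-decreases w c with isPrefix q w in eq
  ... | true = begin-strict
    value (p ++ d)              ≡⟨ cong value (++-assoc u (b ∷ r₁) d) ⟩
    value (u ++ b ∷ (r₁ ++ d))  <⟨ value-++-monoʳ u |u′|≡|v′| (value-head-< {u = r₁ ++ d} {v = r₂ ++ d} |r₁d|≡|r₂d| b<a) ⟩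
    value (u ++ a ∷ (r₂ ++ d))  ≡⟨ cong value (sym (++-assoc u (a ∷ r₂) d)) ⟩
    value (q ++ d)              ≡⟨ cong value (sym (isPrefix-sound q w eq)) ⟩
    value w                     ∎
    where
    open ≤-Reasoning
    d = drop (length q) w
    |r₁d|≡|r₂d| : length (r₁ ++ d) ≡ length (r₂ ++ d)
    |r₁d|≡|r₂d| = trans (length-++ r₁) (trans (cong (_+ length d) |r₁|≡|r₂|) (sym (length-++ r₂)))
    |u′|≡|v′| : length (b ∷ r₁ ++ d) ≡ length (a ∷ r₂ ++ d)
    |u′|≡|v′| = cong suc |r₁d|≡|r₂d|
  L-decreases []      c | false = ⊥-elim (¬Contains-[] eq c)
  L-decreases (x ∷ w) c | false =
    value-++-monoʳ (x ∷ []) {L p q w} {w} (L-length p q |p|≡|q| w) (L-decreases w (Contains-∷⁻ eq c))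

lemma1 : (k : ℕ) (p q : Word k) → length p ≡ length q → ¬ (p ≡ q) → (n : ℕ) → (w : Word k) → A n p w →
    Σ ℕ (λ i → (¬ Contains q (iter i (L p q) w)) × ((j : ℕ) → j < i → Contains q (iter j (L p q) w)) × A n q (iter i (L p q) w))
lemma1 k p q |p|≡|q| p≢q n w (|w|≡n , _) with first-mismatch p q |p|≡|q| p≢q
... | u , b , a , r₁ , r₂ , refl , refl , b≢a with
  first-iterate-outside (L p q) (Contains q) (Contains? q) (Positional.value 2 digit digit<2)
    (L-decreases 2 digit digit<2 u r₁ r₂ |p|≡|q| digit-b<digit-a) w
  where
  digit : Fin k → ℕ
  digit x = if does (b ≟ x) then 0 else 1
  digit<2 : ∀ x → digit x < 2
  digit<2 x with does (b ≟ x)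
  ... | true  = s≤s z≤n
  ... | false = s≤s (s≤s z≤n)
  digit-b<digit-a : digit b < digit a
  digit-b<digit-a rewrite dec-true (b ≟ b) refl | dec-false (b ≟ a) b≢a = s≤s z≤n
... | i , ¬contains , contains-below =
  i , ¬contains , contains-below , trans (iter-L-length p q |p|≡|q| i w) |w|≡n , ¬contains
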